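{- Let $n\in\mathbb{N}$ and $\mathbf{a}\in[n]^n$. Then $\mathbf{a}$ parks every element of its centre $Z(\mathbf{a})$. Moreover, for every $\mathbf{b}\in[n]^n$ whose restriction to $Z(\mathbf{a})$ equals the restriction of $\mathbf{a}$ to $Z(\mathbf{a})$ (i.e. $b_i=a_i$ for all $i\in Z(\mathbf{a})$), $\mathbf{b}$ also parks every element of $Z(\mathbf{a})$.
   Context: $[n]=\{1,\dotsc,n\}$. The Parking Algorithm with input $\mathbf{a}=(a_1,\dotsc,a_n)\in[n]^n$: start with an array $\mathrm{spp}=(0,\dotsc,0)\in\mathbb{Z}^{2n}$ indexed by positions $1,\dotsc,2n$. For each $i\in[n]$ in descending order: set $p=a_i$; while $\mathrm{spp}(p)\neq0$, increase $p$ by one; then set $\mathrm{pp}(i)=p$ and $\mathrm{spp}(p)=i$. We say $\mathbf{a}$ parks $i\in[n]$ if $\mathrm{pp}(i)\leq n$. The centre $Z(\mathbf{a})$ of $\mathbf{a}$ is the largest (possibly empty) set $Z=\{i_1,\dotsc,i_m\}\subseteq[n]$ with $n\ge i_1>\dotsb>i_m\ge1$ such that $a_{i_j}\le j$ for every $j\in[m]$ (the union of two sets with this property has the property, so the largest such set is well defined). -}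

module Defs where

open import Data.Nat using (ℕ; zero; suc; _≤_; _*_; _≡ᵇ_)
open import Data.Bool using (Bool; true; false; if_then_else_)
open import Data.Fin using (Fin; toℕ)
open import Data.Fin.Subset using (Subset; _∈_; _⊆_)
open import Data.Fin.Subset.Properties using (_∈?_)
open import Data.List using (List; allFin; reverse; foldl; filter; length)
open import Data.Product using (_×_; _,_; proj₂)
open import Relation.Nullary.Decidable using (_×-dec_)
import Data.Fin.Properties as FinP

-- Conventions: a word a ∈ [n]^n is a function  a : Fin n → ℕ ;
-- index i : Fin n stands for the element  toℕ i + 1  of [n]
-- (so the order on Fin n is the order on [n]); the value a i is a_i itself.
InRange : (n : ℕ) → (Fin n → ℕ) → Set
InRange n a = ∀ i → 1 ≤ a i × a i ≤ n

-- label of index i in the spp array (i ∈ [n], 0 means "empty")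
label : ∀ {n} → Fin n → ℕ
label i = suc (toℕ i)

update : (ℕ → ℕ) → ℕ → ℕ → (ℕ → ℕ)
update f p v q = if q ≡ᵇ p then v else f q

-- "while spp(p) ≠ 0, increase p by one", with fuel (the loop always stops
-- within n steps because at most n positions are ever occupied; we give 2n fuel).
findFree : (ℕ → ℕ) → ℕ → ℕ → ℕ
findFree spp zero    p = p
findFree spp (suc f) p = if spp p ≡ᵇ 0 then p else findFree spp f (suc p)

State : ℕ → Set
State n = (ℕ → ℕ) × (Fin n → ℕ)

step : ∀ {n} → (Fin n → ℕ) → State n → Fin n → State n
step {n} a (spp , pp) i =
  let p = findFree spp (2 * n) (a i) in
  update spp p (label i) , (λ j → if toℕ j ≡ᵇ toℕ i then p else pp j)

parkingAlgorithm : ∀ {n} → (Fin n → ℕ) → State n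
parkingAlgorithm {n} a = foldl (step a) ((λ _ → 0) , (λ _ → 0)) (reverse (allFin n))

pp : ∀ {n} → (Fin n → ℕ) → Fin n → ℕ
pp a = proj₂ (parkingAlgorithm a)

Parks : ∀ {n} → (Fin n → ℕ) → Fin n → Set
Parks {n} a i = pp a i ≤ n

-- For i ∈ Z, the position j of i in the descending enumeration i₁ > i₂ > … of Z
-- is the number of elements k ∈ Z with k ≥ i.
rankDesc : ∀ {n} → Subset n → Fin n → ℕ
rankDesc {n} Z i = length (filter (λ k → (k ∈? Z) ×-dec (i FinP.≤? k)) (allFin n))

CentreProperty : ∀ {n} → (Fin n → ℕ) → Subset n → Set
CentreProperty a Z = ∀ i → i ∈ Z → a i ≤ rankDesc Z i

IsCentre : ∀ {n} → (Fin n → ℕ) → Subset n → Set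
IsCentre {n} a Z = CentreProperty a Z × (∀ (Z' : Subset n) → CentreProperty a Z' → Z' ⊆ Z)

-- Cars are processed from the largest index down.  If c centre elements have
-- been processed, the spots 1, …, c are all occupied: the next centre element i
-- has rank c + 1 in the descending enumeration of the centre, so b_i ≤ c + 1,
-- and it either finds spot c + 1 taken already or parks exactly there.  Before
-- any car parks, fewer than n of the spots 1, …, n are occupied, so some spot
-- q ≤ n is free; q > c ≥ b_i − 1, hence a centre element parks at or before q.
-- Only the values of b on Z enter, and b inherits the centre property of a on Z.
module Submission where

open import Defs
open import Data.Bool using (true; false; if_then_else_)
open import Data.Fin using (Fin; toℕ)
import Data.Fin as F
import Data.Fin.Properties as FinP
open import Data.Fin.Subset using (Subset; _∈_)
open import Data.Fin.Subset.Properties using (_∈?_)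
open import Data.List using (List; []; _∷_; allFin; foldr; filter; length)
open import Data.List.Properties using (reverse-foldl; length-tabulate; length-filter; filter-accept; filter-reject)
open import Data.List.Membership.Propositional using () renaming (_∈_ to _∈ₗ_)
open import Data.List.Membership.Propositional.Properties using (∈-allFin)
open import Data.List.Relation.Unary.Any using (here; there)
open import Data.List.Relation.Unary.All using (lookup)
open import Data.List.Relation.Unary.AllPairs using (AllPairs; _∷_)
open import Data.List.Relation.Unary.AllPairs.Properties using (tabulate⁺-<)
open import Data.List.Relation.Binary.Sublist.Propositional using (⊆-refl)
open import Data.List.Relation.Binary.Sublist.Propositional.Properties using (filter⁺; length-mono-≤)
open import Data.Nat using (ℕ; zero; suc; _≤_; _<_; z≤n; s≤s; _*_; _+_)
open import Data.Nat.Properties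
open import Data.Product using (_×_; _,_; proj₁; proj₂; ∃)
open import Data.Sum using (inj₁; inj₂)
open import Data.Unit using (⊤; tt)
open import Function using (_∘_; id)
open import Relation.Binary.PropositionalEquality
open import Relation.Nullary using (Dec; yes; no; does; contradiction)
open import Relation.Nullary.Decidable using (_×-dec_; dec-true; dec-false)
open import Relation.Unary using (Decidable)

update-same : ∀ f p v → update f p v p ≡ v
update-same f p v = cong (λ c → if c then v else f p) (dec-true (p ≟ p) refl)

update-other : ∀ f {p q} v → q ≢ p → update f p v q ≡ f q
update-other f {p} {q} v q≢p = cong (λ c → if c then v else f q) (dec-false (q ≟ p) q≢p)

findFree-here : ∀ spp fuel {p} → spp p ≡ 0 → findFree spp (suc fuel) p ≡ p
findFree-here spp fuel {p} free = cong (λ c → if c then p else findFree spp fuel (suc p))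
  (dec-true (spp p ≟ 0) free)

findFree-next : ∀ spp fuel {p} → spp p ≢ 0 → findFree spp (suc fuel) p ≡ findFree spp fuel (suc p)
findFree-next spp fuel {p} taken = cong (λ c → if c then p else findFree spp fuel (suc p))
  (dec-false (spp p ≟ 0) taken)

Occupied : (ℕ → ℕ) → ℕ → Set
Occupied spp p = spp p ≢ 0

FilledUpTo : (ℕ → ℕ) → ℕ → Set
FilledUpTo spp c = ∀ k → 1 ≤ k → k ≤ c → Occupied spp k

update-occupied-here : ∀ spp p v → Occupied (update spp p (suc v)) p
update-occupied-here spp p v e = 1+n≢0 (trans (sym (update-same spp p (suc v))) e)

update-occupied : ∀ spp p v {k} → Occupied spp k → Occupied (update spp p (suc v)) k
update-occupied spp p v {k} taken with k ≟ p
... | yes refl = update-occupied-here spp k v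
... | no k≢p = λ e → taken (trans (sym (update-other spp (suc v) k≢p)) e)

update-filledUpTo : ∀ spp p v {c} → FilledUpTo spp c → FilledUpTo (update spp p (suc v)) c
update-filledUpTo spp p v filled k 1≤k k≤c = update-occupied spp p v (filled k 1≤k k≤c)

findFree-≤-free : ∀ spp fuel {p q} → spp q ≡ 0 → p ≤ q → findFree spp fuel p ≤ q
findFree-≤-free spp zero    q-free p≤q = p≤q
findFree-≤-free spp (suc fuel) {p} {q} q-free p≤q with spp p ≟ 0
... | yes p-free = subst (_≤ q) (sym (findFree-here spp fuel p-free)) p≤q
... | no p-taken = subst (_≤ q) (sym (findFree-next spp fuel p-taken))
      (findFree-≤-free spp fuel q-free (≤∧≢⇒< p≤q λ { refl → p-taken q-free }))

findFree-first-free : ∀ spp fuel {p k} → spp k ≡ 0 → (∀ q → p ≤ q → q < k → Occupied spp q) →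
                      p ≤ k → k < p + fuel → findFree spp fuel p ≡ k
findFree-first-free spp zero {p} {k} _ _ p≤k k<p+0 =
  contradiction (subst (k <_) (+-identityʳ p) k<p+0) (≤⇒≯ p≤k)
findFree-first-free spp (suc fuel) {p} {k} k-free between p≤k k<p+fuel with m≤n⇒m<n∨m≡n p≤k
... | inj₂ refl = findFree-here spp fuel k-free
... | inj₁ p<k = trans (findFree-next spp fuel (between p ≤-refl p<k))
  (findFree-first-free spp fuel k-free (λ q p<q → between q (<⇒≤ p<q)) p<k
    (subst (k <_) (+-suc p fuel) k<p+fuel))

findFree-fills : ∀ spp fuel {p c} v → 1 ≤ p → p ≤ suc c → suc c < p + fuel → FilledUpTo spp c →
                 FilledUpTo (update spp (findFree spp fuel p) (suc v)) (suc c)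
findFree-fills spp fuel {p} {c} v 1≤p p≤c+1 enough-fuel filled k 1≤k k≤c+1
  with m≤n⇒m<n∨m≡n k≤c+1
... | inj₁ k<c+1 = update-occupied spp (findFree spp fuel p) v (filled k 1≤k (≤-pred k<c+1))
... | inj₂ refl with spp k ≟ 0
...   | no taken = update-occupied spp (findFree spp fuel p) v taken
...   | yes free = subst (λ r → Occupied (update spp r (suc v)) k) (sym lands-at-k)
                     (update-occupied-here spp k v)
  where
  lands-at-k : findFree spp fuel p ≡ k
  lands-at-k = findFree-first-free spp fuel free
    (λ q p≤q q<k → filled q (≤-trans 1≤p p≤q) (≤-pred q<k)) p≤c+1 enough-fuel

occupancy : ℕ → ℕ
occupancy zero    = 0
occupancy (suc _) = 1

occupancy≤1 : ∀ v → occupancy v ≤ 1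
occupancy≤1 zero    = z≤n
occupancy≤1 (suc _) = ≤-refl

occupiedCount : (ℕ → ℕ) → ℕ → ℕ
occupiedCount spp zero    = 0
occupiedCount spp (suc m) = occupancy (spp (suc m)) + occupiedCount spp m

occupiedCount-cong : ∀ {f g} m → (∀ q → q ≤ m → f q ≡ g q) → occupiedCount f m ≡ occupiedCount g m
occupiedCount-cong zero    f≗g = refl
occupiedCount-cong (suc m) f≗g =
  cong₂ _+_ (cong occupancy (f≗g (suc m) ≤-refl))
            (occupiedCount-cong m λ q q≤m → f≗g q (m≤n⇒m≤1+n q≤m))

occupiedCount-empty : ∀ m → occupiedCount (λ _ → 0) m ≡ 0
occupiedCount-empty zero    = refl
occupiedCount-empty (suc m) = occupiedCount-empty m

occupiedCount-update : ∀ spp p v m → occupiedCount (update spp p v) m ≤ suc (occupiedCount spp m)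
occupiedCount-update spp p v zero = z≤n
occupiedCount-update spp p v (suc m) with suc m ≟ p
... | yes refl = begin
  occupancy (update spp (suc m) v (suc m)) + occupiedCount (update spp (suc m) v) m
    ≡⟨ cong₂ _+_ (cong occupancy (update-same spp (suc m) v))
                 (occupiedCount-cong m λ q q≤m → update-other spp v (<⇒≢ (s≤s q≤m))) ⟩
  occupancy v + occupiedCount spp m                     ≤⟨ +-monoˡ-≤ _ (occupancy≤1 v) ⟩
  suc (occupiedCount spp m)                             ≤⟨ s≤s (m≤n+m _ _) ⟩
  suc (occupancy (spp (suc m)) + occupiedCount spp m)   ∎
  where open ≤-Reasoning
... | no m+1≢p = begin
  occupancy (update spp p v (suc m)) + occupiedCount (update spp p v) m
    ≡⟨ cong (λ x → occupancy x + occupiedCount (update spp p v) m) (update-other spp v m+1≢p) ⟩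
  occupancy (spp (suc m)) + occupiedCount (update spp p v) m
    ≤⟨ +-monoʳ-≤ (occupancy (spp (suc m))) (occupiedCount-update spp p v m) ⟩
  occupancy (spp (suc m)) + suc (occupiedCount spp m)   ≡⟨ +-suc _ _ ⟩
  suc (occupancy (spp (suc m)) + occupiedCount spp m)   ∎
  where open ≤-Reasoning

free-spot : ∀ spp m → occupiedCount spp m < m → ∃ λ q → 1 ≤ q × q ≤ m × spp q ≡ 0
free-spot spp (suc m) count<m with spp (suc m) in e
... | zero  = suc m , s≤s z≤n , ≤-refl , e
... | suc _ with free-spot spp m (≤-pred count<m)
...   | q , 1≤q , q≤m , free = q , 1≤q , m≤n⇒m≤1+n q≤m , free

findFree-≤-count : ∀ spp fuel {p c m} → occupiedCount spp m < m → FilledUpTo spp c → p ≤ suc c →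
                   findFree spp fuel p ≤ m
findFree-≤-count spp fuel {p} {c} {m} count<m filled p≤c+1 with free-spot spp m count<m
... | q , 1≤q , q≤m , free =
  ≤-trans (findFree-≤-free spp fuel free (≤-trans p≤c+1 c<q)) q≤m
  where
  c<q : c < q
  c<q = ≰⇒> λ q≤c → filled q 1≤q q≤c free

length-filter-∷ : ∀ {A : Set} {P : A → Set} (P? : Decidable P) x xs →
                  length (filter P? (x ∷ xs)) ≤ suc (length (filter P? xs))
length-filter-∷ P? x xs with does (P? x)
... | true  = ≤-refl
... | false = n≤1+n _

module _ {n : ℕ} (b : Fin n → ℕ) where

  run : List (Fin n) → State n
  run = foldr (λ i s → step b s i) ((λ _ → 0) , (λ _ → 0))

  sppAfter : List (Fin n) → ℕ → ℕ
  sppAfter xs = proj₁ (run xs)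

  ppAfter : List (Fin n) → Fin n → ℕ
  ppAfter xs = proj₂ (run xs)

  spot : Fin n → List (Fin n) → ℕ
  spot i ys = findFree (sppAfter ys) (2 * n) (b i)

  parkingAlgorithm-run : parkingAlgorithm b ≡ run (allFin n)
  parkingAlgorithm-run = reverse-foldl (step b) _ (allFin n)

  ppAfter-self : ∀ i ys → ppAfter (i ∷ ys) i ≡ spot i ys
  ppAfter-self i ys = cong (λ c → if c then spot i ys else ppAfter ys i) (dec-true (toℕ i ≟ toℕ i) refl)

  ppAfter-other : ∀ {i j} ys → j ≢ i → ppAfter (i ∷ ys) j ≡ ppAfter ys j
  ppAfter-other {i} {j} ys j≢i = cong (λ c → if c then spot i ys else ppAfter ys j)
    (dec-false (toℕ j ≟ toℕ i) (j≢i ∘ FinP.toℕ-injective))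

  occupiedCount-run : ∀ xs → occupiedCount (sppAfter xs) n ≤ length xs
  occupiedCount-run []       = ≤-reflexive (occupiedCount-empty n)
  occupiedCount-run (i ∷ ys) = ≤-trans (occupiedCount-update (sppAfter ys) (spot i ys) (label i) n)
                                       (s≤s (occupiedCount-run ys))

  module _ (Z : Subset n) where

    centreCount : List (Fin n) → ℕ
    centreCount xs = length (filter (_∈? Z) xs)

    centreFrom? : (i : Fin n) → Decidable (λ k → k ∈ Z × i F.≤ k)
    centreFrom? i k = (k ∈? Z) ×-dec (i FinP.≤? k)

    rankIn : List (Fin n) → Fin n → ℕ
    rankIn xs i = length (filter (centreFrom? i) xs)

    RankBounded : List (Fin n) → Set
    RankBounded []       = ⊤
    RankBounded (i ∷ ys) = (i ∈ Z → b i ≤ suc (centreCount ys)) × RankBounded ys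

    rankIn-head : ∀ x ys → rankIn (x ∷ ys) x ≤ suc (centreCount ys)
    rankIn-head x ys = ≤-trans (length-filter-∷ (centreFrom? x) x ys)
      (s≤s (length-mono-≤
        (filter⁺ (centreFrom? x) (_∈? Z) (λ { refl → proj₁ }) (⊆-refl {x = ys}))))

    rankIn-skip : ∀ {i x} ys → x F.< i → rankIn (x ∷ ys) i ≡ rankIn ys i
    rankIn-skip {i} ys x<i = cong length (filter-reject (centreFrom? i) (<⇒≱ x<i ∘ proj₂))

    rankBounded : ∀ xs → AllPairs F._<_ xs → (∀ i → i ∈ₗ xs → i ∈ Z → b i ≤ rankIn xs i) →
                  RankBounded xs
    rankBounded []       _            _       = tt
    rankBounded (x ∷ ys) (x<ys ∷ ys↑) bounded =
      (λ x∈Z → ≤-trans (bounded x (here refl) x∈Z) (rankIn-head x ys)) ,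
      rankBounded ys ys↑ λ i i∈ys i∈Z →
        subst (b i ≤_) (rankIn-skip ys (lookup x<ys i∈ys)) (bounded i (there i∈ys) i∈Z)

    run-filledUpTo : (∀ i → 1 ≤ b i) → ∀ xs → length xs ≤ n → RankBounded xs →
                     FilledUpTo (sppAfter xs) (centreCount xs)
    run-filledUpTo b≥1 []       _   _ = λ { k (s≤s _) () }
    run-filledUpTo b≥1 (i ∷ ys) len (i-bounded , ys-bounded) = filled-∷ (i ∈? Z)
      where
      ys-filled : FilledUpTo (sppAfter ys) (centreCount ys)
      ys-filled = run-filledUpTo b≥1 ys (<⇒≤ len) ys-bounded
      enough-fuel : suc (centreCount ys) < b i + 2 * n
      enough-fuel = +-mono-≤ (b≥1 i)
        (≤-trans (≤-trans (s≤s (length-filter (_∈? Z) ys)) len) (m≤n*m n 2))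
      filled-∷ : Dec (i ∈ Z) → FilledUpTo (sppAfter (i ∷ ys)) (centreCount (i ∷ ys))
      filled-∷ (no i∉Z) =
        subst (FilledUpTo (sppAfter (i ∷ ys))) (sym (cong length (filter-reject (_∈? Z) i∉Z)))
          (update-filledUpTo (sppAfter ys) (spot i ys) (toℕ i) ys-filled)
      filled-∷ (yes i∈Z) =
        subst (FilledUpTo (sppAfter (i ∷ ys))) (sym (cong length (filter-accept (_∈? Z) i∈Z)))
          (findFree-fills (sppAfter ys) (2 * n) (toℕ i) (b≥1 i) (i-bounded i∈Z) enough-fuel ys-filled)

    run-parks : (∀ i → 1 ≤ b i) → ∀ xs → length xs ≤ n → RankBounded xs →
                ∀ j → j ∈ Z → j ∈ₗ xs → ppAfter xs j ≤ n
    run-parks b≥1 (i ∷ ys) len (i-bounded , ys-bounded) j j∈Z j∈xs = parks j∈xs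
      where
      spot≤n : i ∈ Z → spot i ys ≤ n
      spot≤n i∈Z = findFree-≤-count (sppAfter ys) (2 * n) (≤-trans (s≤s (occupiedCount-run ys)) len)
        (run-filledUpTo b≥1 ys (<⇒≤ len) ys-bounded) (i-bounded i∈Z)
      parks : j ∈ₗ i ∷ ys → ppAfter (i ∷ ys) j ≤ n
      parks (here refl) = subst (_≤ n) (sym (ppAfter-self j ys)) (spot≤n j∈Z)
      parks (there j∈ys) with j F.≟ i
      ... | yes refl = subst (_≤ n) (sym (ppAfter-self j ys)) (spot≤n j∈Z)
      ... | no j≢i   = subst (_≤ n) (sym (ppAfter-other ys j≢i))
                         (run-parks b≥1 ys (<⇒≤ len) ys-bounded j j∈Z j∈ys)

    centreProperty-parks : (∀ i → 1 ≤ b i) → CentreProperty b Z → ∀ i → i ∈ Z → Parks b i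
    centreProperty-parks b≥1 centre i i∈Z =
      subst (λ s → proj₂ s i ≤ n) (sym parkingAlgorithm-run)
        (run-parks b≥1 (allFin n) (≤-reflexive (length-tabulate id)) bounded i i∈Z (∈-allFin i))
      where
      bounded : RankBounded (allFin n)
      bounded = rankBounded (allFin n) (tabulate⁺-< id) λ j _ → centre j

proposition3p7 : (n : ℕ) (a : Fin n → ℕ) → InRange n a →
    (Z : Subset n) → IsCentre a Z →
    (∀ i → i ∈ Z → Parks a i) ×
    (∀ (b : Fin n → ℕ) → InRange n b → (∀ i → i ∈ Z → b i ≡ a i) →
      ∀ i → i ∈ Z → Parks b i)
proposition3p7 n a a-range Z (centre , _) =
  centreProperty-parks a Z (proj₁ ∘ a-range) centre ,
  λ b b-range b≡a → centreProperty-parks b Z (proj₁ ∘ b-range)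
    λ i i∈Z → subst (_≤ rankDesc Z i) (sym (b≡a i i∈Z)) (centre i i∈Z)
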